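{- For all integers $n>1$ and $0\le k,\ell\le n$, \[ G_n(k,\ell)=\bigcup_{\substack{1\le p,q<n\\ m=p+q-n\\ 0\le m<p,\ 0\le m<q}} G_p(k,m)\,\ast\, G_q(m,\ell)\;\cup\;\bigcup_{\substack{p+q=n\\ p,q\ge1\\ k_1+k_2=k\\ \ell_1+\ell_2=\ell}} G_p(k_1,\ell_1)\otimes G_q(k_2,\ell_2). \]
   Context: A poset is a finite set with an irreflexive transitive relation $<$; $P^{\min}$, $P^{\max}$ denote its sets of minimal and maximal elements. Let $[n]=\{1,\dots,n\}$ ($[0]=\emptyset$). An iposet $(s,P,t):n\to m$ is a poset $P$ with injective maps $s:[n]\to P$, $t:[m]\to P$ such that $s([n])\subseteq P^{\min}$ and $t([m])\subseteq P^{\max}$; write $\mathrm{src}(P)=n$, $\mathrm{tgt}(P)=m$. Iposets $(s_1,P_1,t_1)$, $(s_2,P_2,t_2)$ are isomorphic if there is a poset isomorphism $f:P_1\to P_2$ with $f\circ s_1=s_2$, $f\circ t_1=t_2$. For iposets $(s_1,P_1,t_1):n_1\to m_1$ and $(s_2,P_2,t_2):n_2\to m_2$: the parallel composition $P_1\otimes P_2:n_1+n_2\to m_1+m_2$ has carrier the disjoint union $P_1\sqcup P_2=\{(p,1)\}\cup\{(q,2)\}$, order $(p,i)<(q,j)$ iff $i=j$ and $p<_iq$, source map sending $i\le n_1$ to $(s_1(i),1)$ and $i>n_1$ to $(s_2(i-n_1),2)$, and target map defined analogously. If $m_1=n_2$, the gluing composition $P_1\ast P_2:n_1\to m_2$ has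 carrier the quotient of $P_1\sqcup P_2$ identifying $(t_1(k),1)$ with $(s_2(k),2)$ for every $k\in[m_1]$, order $(p,i)<(q,j)$ iff ($i=j$ and $p<_iq$) or ($i<j$, $p\notin t_1([m_1])$ and $q\notin s_2([n_2])$), source map induced by $s_1$ and target map induced by $t_2$. An iposet is gluing-parallel (gp) if it is empty or obtained from the four iposets on a one-point poset (with $0$ or $1$ source points and $0$ or $1$ target points) by finitely many applications of $\ast$ and $\otimes$. $G_n$ is the set of isomorphism classes of gp-iposets on $n$ points, and $G_n(k,\ell)=\{P\in G_n:\mathrm{src}(P)=k,\ \mathrm{tgt}(P)=\ell\}$. For sets $A,B$ of isomorphism classes, $A\ast B$ and $A\otimes B$ denote the sets of isomorphism classes of all (defined) compositions $P\ast Q$, resp. $P\otimes Q$, with $P\in A$, $Q\in B$. -}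

module Defs where

open import Data.Nat using (ℕ; zero; suc; _+_; _≤_; _<_; z≤n; s≤s)
open import Data.Fin using (Fin; splitAt; join)
open import Data.Fin.Properties using (any?; join-splitAt)
open import Data.Sum using (_⊎_; inj₁; inj₂; [_,_])
open import Data.Sum.Properties using (inj₁-injective; inj₂-injective)
import Data.Sum.Properties as SumP
open import Data.Product using (Σ; ∃; ∃-syntax; _×_; _,_; proj₁; proj₂)
open import Data.Unit using (⊤; tt)
open import Data.Empty using (⊥; ⊥-elim)
open import Data.Bool using (Bool; true; false; T)
open import Relation.Nullary using (¬_; Dec; yes; no)
open import Relation.Nullary.Decidable using (False; fromWitnessFalse)
open import Relation.Binary.PropositionalEquality using (_≡_; refl; sym; trans; cong; subst)
open import Relation.Binary.Definitions using (DecidableEquality)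
open import Function.Bundles using (_↔_; Inverse; _⇔_)

-- Iposets  (s,P,t) : n → m.
-- The carrier is an arbitrary type with decidable equality (every finite
-- set has one); the number of points is imposed separately by HasSize.

record Iposet (n m : ℕ) : Set₁ where
  field
    Carrier : Set
    _≟_     : DecidableEquality Carrier
    _<ₚ_    : Carrier → Carrier → Set
    irrefl  : ∀ x → ¬ (x <ₚ x)
    trans<  : ∀ {x y z} → x <ₚ y → y <ₚ z → x <ₚ z
    s       : Fin n → Carrier
    s-inj   : ∀ i j → s i ≡ s j → i ≡ j
    s-min   : ∀ i x → ¬ (x <ₚ s i)
    t       : Fin m → Carrier
    t-inj   : ∀ i j → t i ≡ t j → i ≡ j
    t-max   : ∀ i x → ¬ (t i <ₚ x)

HasSize : ∀ {n m} → Iposet n m → ℕ → Set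
HasSize P k = Iposet.Carrier P ↔ Fin k

record _≅_ {n m : ℕ} (P Q : Iposet n m) : Set where
  private
    module P = Iposet P
    module Q = Iposet Q
  field
    iso     : P.Carrier ↔ Q.Carrier
  f : P.Carrier → Q.Carrier
  f = Inverse.to iso
  field
    order   : ∀ x y → (x P.<ₚ y) ⇔ (f x Q.<ₚ f y)
    src-com : ∀ i → f (P.s i) ≡ Q.s i
    tgt-com : ∀ i → f (P.t i) ≡ Q.t i

cast : ∀ {n n' m m'} → n ≡ n' → m ≡ m' → Iposet n m → Iposet n' m'
cast refl refl P = P

fin≤1 : ∀ {n} → n ≤ 1 → (i j : Fin n) → i ≡ j
fin≤1 z≤n () _
fin≤1 (s≤s z≤n) Fin.zero Fin.zero = refl

point : ∀ n m → n ≤ 1 → m ≤ 1 → Iposet n m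
point n m hn hm = record
  { Carrier = ⊤
  ; _≟_ = λ { tt tt → yes refl }
  ; _<ₚ_ = λ _ _ → ⊥
  ; irrefl = λ _ ()
  ; trans< = λ ()
  ; s = λ _ → tt
  ; s-inj = λ i j _ → fin≤1 hn i j
  ; s-min = λ _ _ ()
  ; t = λ _ → tt
  ; t-inj = λ i j _ → fin≤1 hm i j
  ; t-max = λ _ _ ()
  }

module Par {n₁ m₁ n₂ m₂ : ℕ} (P : Iposet n₁ m₁) (Q : Iposet n₂ m₂) where
  private
    module P = Iposet P
    module Q = Iposet Q

  C : Set
  C = P.Carrier ⊎ Q.Carrier

  _<'_ : C → C → Set
  inj₁ a <' inj₁ b = a P.<ₚ b
  inj₁ a <' inj₂ b = ⊥
  inj₂ a <' inj₁ b = ⊥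
  inj₂ a <' inj₂ b = a Q.<ₚ b

  irr : ∀ x → ¬ (x <' x)
  irr (inj₁ a) = P.irrefl a
  irr (inj₂ a) = Q.irrefl a

  tr : ∀ x y z → x <' y → y <' z → x <' z
  tr (inj₁ x) (inj₁ y) (inj₁ z) p q = P.trans< p q
  tr (inj₂ x) (inj₂ y) (inj₂ z) p q = Q.trans< p q
  tr (inj₁ x) (inj₁ y) (inj₂ z) p ()
  tr (inj₁ x) (inj₂ y) z () q
  tr (inj₂ x) (inj₁ y) z () q
  tr (inj₂ x) (inj₂ y) (inj₁ z) p ()

  srcF : Fin n₁ ⊎ Fin n₂ → C
  srcF (inj₁ a) = inj₁ (P.s a)
  srcF (inj₂ b) = inj₂ (Q.s b)

  tgtF : Fin m₁ ⊎ Fin m₂ → C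
  tgtF (inj₁ a) = inj₁ (P.t a)
  tgtF (inj₂ b) = inj₂ (Q.t b)

  src : Fin (n₁ + n₂) → C
  src i = srcF (splitAt n₁ i)

  tgt : Fin (m₁ + m₂) → C
  tgt i = tgtF (splitAt m₁ i)

  sInj : (u v : Fin n₁ ⊎ Fin n₂) →
         srcF u ≡
         srcF v → u ≡ v
  sInj (inj₁ a) (inj₁ b) e = cong inj₁ (P.s-inj a b (inj₁-injective e))
  sInj (inj₂ a) (inj₂ b) e = cong inj₂ (Q.s-inj a b (inj₂-injective e))
  sInj (inj₁ a) (inj₂ b) ()
  sInj (inj₂ a) (inj₁ b) ()

  tInj : (u v : Fin m₁ ⊎ Fin m₂) →
         tgtF u ≡
         tgtF v → u ≡ v
  tInj (inj₁ a) (inj₁ b) e = cong inj₁ (P.t-inj a b (inj₁-injective e))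
  tInj (inj₂ a) (inj₂ b) e = cong inj₂ (Q.t-inj a b (inj₂-injective e))
  tInj (inj₁ a) (inj₂ b) ()
  tInj (inj₂ a) (inj₁ b) ()

  sMin : (u : Fin n₁ ⊎ Fin n₂) → ∀ x →
         ¬ (x <' srcF u)
  sMin (inj₁ a) (inj₁ y) lt = P.s-min a y lt
  sMin (inj₁ a) (inj₂ y) ()
  sMin (inj₂ b) (inj₁ y) ()
  sMin (inj₂ b) (inj₂ y) lt = Q.s-min b y lt

  tMax : (u : Fin m₁ ⊎ Fin m₂) → ∀ x →
         ¬ (tgtF u <' x)
  tMax (inj₁ a) (inj₁ y) lt = P.t-max a y lt
  tMax (inj₁ a) (inj₂ y) ()
  tMax (inj₂ b) (inj₁ y) ()
  tMax (inj₂ b) (inj₂ y) lt = Q.t-max b y lt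

  result : Iposet (n₁ + n₂) (m₁ + m₂)
  result = record
    { Carrier = C
    ; _≟_ = SumP.≡-dec P._≟_ Q._≟_
    ; _<ₚ_ = _<'_
    ; irrefl = irr
    ; trans< = λ {x} {y} {z} → tr x y z
    ; s = src
    ; s-inj = λ i j e → trans (sym (join-splitAt n₁ n₂ i))
                (trans (cong (join n₁ n₂) (sInj (splitAt n₁ i) (splitAt n₁ j) e))
                       (join-splitAt n₁ n₂ j))
    ; s-min = λ i → sMin (splitAt n₁ i)
    ; t = tgt
    ; t-inj = λ i j e → trans (sym (join-splitAt m₁ m₂ i))
                (trans (cong (join m₁ m₂) (tInj (splitAt m₁ i) (splitAt m₁ j) e))
                       (join-splitAt m₁ m₂ j))
    ; t-max = λ i → tMax (splitAt m₁ i)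
    }

_⊗_ : ∀ {n₁ m₁ n₂ m₂} → Iposet n₁ m₁ → Iposet n₂ m₂ → Iposet (n₁ + n₂) (m₁ + m₂)
P ⊗ Q = Par.result P Q

-- The quotient of P ⊔ Q identifying t_P(k) with s_Q(k) is represented by
-- P ⊎ {q ∈ Q | q ∉ s_Q([k])}; each glued element has a P-representative
-- (R1) and/or a Q-representative (R2), and the order is the one of the
-- definition, stated through representatives.

T-irr : ∀ {b : Bool} (x y : T b) → x ≡ y
T-irr {true} tt tt = refl

module Glue {n k m : ℕ} (P : Iposet n k) (Q : Iposet k m) where
  private
    module P = Iposet P
    module Q = Iposet Q

  InS : Q.Carrier → Set
  InS b = ∃[ i ] Q.s i ≡ b

  InS? : ∀ b → Dec (InS b)
  InS? b = any? (λ i → Q.s i Q.≟ b)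

  InT : P.Carrier → Set
  InT a = ∃[ i ] P.t i ≡ a

  Q' : Set
  Q' = Σ Q.Carrier (λ b → False (InS? b))

  C : Set
  C = P.Carrier ⊎ Q'

  R1 : C → P.Carrier → Set
  R1 (inj₁ a) a' = a ≡ a'
  R1 (inj₂ _) _ = ⊥

  R2 : C → Q.Carrier → Set
  R2 (inj₁ a) b = ∃[ i ] (P.t i ≡ a × Q.s i ≡ b)
  R2 (inj₂ (b , _)) b' = b ≡ b'

  _<'_ : C → C → Set
  x <' y = (∃[ a ] ∃[ a' ] (R1 x a × R1 y a' × a P.<ₚ a'))
         ⊎ (∃[ b ] ∃[ b' ] (R2 x b × R2 y b' × b Q.<ₚ b'))
         ⊎ (∃[ a ] ∃[ b ] (R1 x a × ¬ InT a × R2 y b × ¬ InS b))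

  R1-fun : ∀ x {a a'} → R1 x a → R1 x a' → a ≡ a'
  R1-fun (inj₁ _) e e' = trans (sym e) e'
  R1-fun (inj₂ _) ()

  R2-fun : ∀ x {b b'} → R2 x b → R2 x b' → b ≡ b'
  R2-fun (inj₁ a) (i , ta , sb) (j , ta' , sb') =
    trans (sym sb) (trans (cong Q.s (P.t-inj i j (trans ta (sym ta')))) sb')
  R2-fun (inj₂ _) e e' = trans (sym e) e'

  R12-T : ∀ x {a b} → R1 x a → R2 x b → InT a
  R12-T (inj₁ _) e (i , ta , _) = i , trans ta e
  R12-T (inj₂ _) ()

  R12-S : ∀ x {a b} → R1 x a → R2 x b → InS b
  R12-S (inj₁ _) e (i , _ , sb) = i , sb
  R12-S (inj₂ _) ()

  below-T : ∀ {a a'} → a P.<ₚ a' → ¬ InT a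
  below-T {a' = a'} lt (i , ti) = P.t-max i a' (subst (P._<ₚ a') (sym ti) lt)

  above-S : ∀ {b b'} → b Q.<ₚ b' → ¬ InS b'
  above-S {b = b} lt (i , si) = Q.s-min i b (subst (b Q.<ₚ_) (sym si) lt)

  irr : ∀ x → ¬ (x <' x)
  irr x (inj₁ (a , a' , r , r' , lt)) = P.irrefl a' (subst (P._<ₚ a') (R1-fun x r r') lt)
  irr x (inj₂ (inj₁ (b , b' , r , r' , lt))) = Q.irrefl b' (subst (Q._<ₚ b') (R2-fun x r r') lt)
  irr x (inj₂ (inj₂ (a , b , r , nT , r' , nS))) = nT (R12-T x r r')

  tr : ∀ x y z → x <' y → y <' z → x <' z
  tr x y z (inj₁ (a , a₁ , r , r₁ , lt)) (inj₁ (a₂ , a₃ , r₂ , r₃ , lt')) =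
    inj₁ (a , a₃ , r , r₃ , P.trans< lt (subst (P._<ₚ a₃) (sym (R1-fun y r₁ r₂)) lt'))
  tr x y z (inj₂ (inj₁ (b , b₁ , r , r₁ , lt))) (inj₂ (inj₁ (b₂ , b₃ , r₂ , r₃ , lt'))) =
    inj₂ (inj₁ (b , b₃ , r , r₃ , Q.trans< lt (subst (Q._<ₚ b₃) (sym (R2-fun y r₁ r₂)) lt')))
  tr x y z (inj₁ (a , a₁ , r , r₁ , lt)) (inj₂ (inj₁ (b , b₁ , r₂ , r₃ , lt'))) =
    inj₂ (inj₂ (a , b₁ , r , below-T lt , r₃ , above-S lt'))
  tr x y z (inj₂ (inj₁ (b , b₁ , r , r₁ , lt))) (inj₁ (a , a₁ , r₂ , r₃ , lt')) =
    ⊥-elim (above-S lt (R12-S y r₂ r₁))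
  tr x y z (inj₁ (a , a₁ , r , r₁ , lt)) (inj₂ (inj₂ (a₂ , b , r₂ , nT , r₃ , nS))) =
    inj₂ (inj₂ (a , b , r , below-T lt , r₃ , nS))
  tr x y z (inj₂ (inj₂ (a , b , r , nT , r₁ , nS))) (inj₂ (inj₁ (b₂ , b₃ , r₂ , r₃ , lt))) =
    inj₂ (inj₂ (a , b₃ , r , nT , r₃ , above-S lt))
  tr x y z (inj₂ (inj₂ (a , b , r , nT , r₁ , nS))) (inj₁ (a₂ , a₃ , r₂ , r₃ , lt)) =
    ⊥-elim (nS (R12-S y r₂ r₁))
  tr x y z (inj₂ (inj₁ (b , b₁ , r , r₁ , lt))) (inj₂ (inj₂ (a , b₂ , r₂ , nT , r₃ , nS))) =
    ⊥-elim (above-S lt (R12-S y r₂ r₁))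
  tr x y z (inj₂ (inj₂ (a , b , r , nT , r₁ , nS))) (inj₂ (inj₂ (a₂ , b₂ , r₂ , nT' , r₃ , nS'))) =
    ⊥-elim (nS (R12-S y r₂ r₁))

  src : Fin n → C
  src i = inj₁ (P.s i)

  s-min' : ∀ i x → ¬ (x <' src i)
  s-min' i x (inj₁ (a , a' , r , r' , lt)) = P.s-min i a (subst (a P.<ₚ_) (sym r') lt)
  s-min' i x (inj₂ (inj₁ (b , b' , r , (j , _ , sj) , lt))) =
    Q.s-min j b (subst (b Q.<ₚ_) (sym sj) lt)
  s-min' i x (inj₂ (inj₂ (a , b , r , nT , (j , _ , sj) , nS))) = nS (j , sj)

  tgtOf : (b : Q.Carrier) → Dec (InS b) → C
  tgtOf b (yes (i , _)) = inj₁ (P.t i)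
  tgtOf b (no ¬s) = inj₂ (b , fromWitnessFalse ¬s)

  tgt : Fin m → C
  tgt j = tgtOf (Q.t j) (InS? (Q.t j))

  R2-tgtOf : ∀ b d → R2 (tgtOf b d) b
  R2-tgtOf b (yes (i , si)) = i , refl , si
  R2-tgtOf b (no _) = refl

  t-inj' : ∀ i j → tgt i ≡ tgt j → i ≡ j
  t-inj' i j e = Q.t-inj i j
    (R2-fun (tgt i) (R2-tgtOf (Q.t i) (InS? (Q.t i)))
      (subst (λ x → R2 x (Q.t j)) (sym e) (R2-tgtOf (Q.t j) (InS? (Q.t j)))))

  t-max' : ∀ j x → ¬ (tgt j <' x)
  t-max' j x (inj₁ (a , a' , r , r' , lt)) =
    below-T lt (R12-T (tgt j) r (R2-tgtOf (Q.t j) (InS? (Q.t j))))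
  t-max' j x (inj₂ (inj₁ (b , b' , r , r' , lt))) =
    Q.t-max j b' (subst (Q._<ₚ b') (R2-fun (tgt j) r (R2-tgtOf (Q.t j) (InS? (Q.t j)))) lt)
  t-max' j x (inj₂ (inj₂ (a , b , r , nT , r' , nS))) =
    nT (R12-T (tgt j) r (R2-tgtOf (Q.t j) (InS? (Q.t j))))

  decQ' : DecidableEquality Q'
  decQ' (b , p) (b' , p') with b Q.≟ b'
  ... | yes refl = yes (cong (b ,_) (T-irr p p'))
  ... | no ne = no (λ e → ne (cong proj₁ e))

  result : Iposet n m
  result = record
    { Carrier = C
    ; _≟_ = SumP.≡-dec P._≟_ decQ'
    ; _<ₚ_ = _<'_
    ; irrefl = irr
    ; trans< = λ {x} {y} {z} → tr x y z
    ; s = src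
    ; s-inj = λ i j e → P.s-inj i j (inj₁-injective e)
    ; s-min = s-min'
    ; t = tgt
    ; t-inj = t-inj'
    ; t-max = t-max'
    }

_∗_ : ∀ {n k m} → Iposet n k → Iposet k m → Iposet n m
P ∗ Q = Glue.result P Q

data GPTerm : ℕ → ℕ → Set where
  pt   : ∀ {n m} → n ≤ 1 → m ≤ 1 → GPTerm n m
  glue : ∀ {n k m} → GPTerm n k → GPTerm k m → GPTerm n m
  par  : ∀ {n₁ m₁ n₂ m₂} → GPTerm n₁ m₁ → GPTerm n₂ m₂ → GPTerm (n₁ + n₂) (m₁ + m₂)

⟦_⟧ : ∀ {n m} → GPTerm n m → Iposet n m
⟦ pt {n} {m} hn hm ⟧ = point n m hn hm
⟦ glue a b ⟧ = ⟦ a ⟧ ∗ ⟦ b ⟧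
⟦ par a b ⟧ = ⟦ a ⟧ ⊗ ⟦ b ⟧

IsGP : ∀ {n m} → Iposet n m → Set
IsGP P = (¬ Iposet.Carrier P) ⊎ (∃[ e ] (P ≅ ⟦ e ⟧))

InG : ∀ {k ℓ} → ℕ → Iposet k ℓ → Set
InG p P = IsGP P × HasSize P p

InGlueUnion : ∀ {k ℓ} → ℕ → Iposet k ℓ → Set₁
InGlueUnion {k} {ℓ} n P =
  ∃[ p ] ∃[ q ] ∃[ m ]
    (1 ≤ p × p < n × 1 ≤ q × q < n × m + n ≡ p + q × m < p × m < q ×
     (∃[ P₁ ] ∃[ P₂ ] (InG {k} {m} p P₁ × InG {m} {ℓ} q P₂ × (P ≅ (P₁ ∗ P₂)))))

InParUnion : ∀ {k ℓ} → ℕ → Iposet k ℓ → Set₁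
InParUnion {k} {ℓ} n P =
  ∃[ p ] ∃[ q ] ∃[ k₁ ] ∃[ k₂ ] ∃[ ℓ₁ ] ∃[ ℓ₂ ]
    (p + q ≡ n × 1 ≤ p × 1 ≤ q ×
     Σ (k₁ + k₂ ≡ k) λ ek → Σ (ℓ₁ + ℓ₂ ≡ ℓ) λ eℓ →
     (∃[ P₁ ] ∃[ P₂ ] (InG {k₁} {ℓ₁} p P₁ × InG {k₂} {ℓ₂} q P₂ ×
                       (P ≅ cast ek eℓ (P₁ ⊗ P₂)))))

-- The inclusion ⊇ holds because ∗ and ⊗ of gp-iposets are gp and
-- sizes add up (p + q − m for a gluing, whose m interface points are identified).
-- For ⊆, write P ≅ ⟦ e ⟧ for a gp-term e; as P has at least two points, e is a
-- gluing or a parallel composition. A parallel composition lies in the second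
-- union. A gluing ⟦ a ⟧ ∗ ⟦ b ⟧ over c interface points lies in the first union
-- when c < |a| and c < |b|. Otherwise every point of a is a target (or every
-- point of b is a source), the gluing collapses to b (or a) with restricted
-- interfaces, and we recurse. The recursion has to stay among gp-iposets, which
-- is why interfaces are only restricted along order-preserving embeddings:
-- these are the restrictions that commute with ⊗ and ∗. The collapsed
-- interfaces are of that kind because in a gp-iposet the points that are both
-- sources and targets have their source and target indices in the same order.

module Submission where

open import Defs
open import Data.Nat using (ℕ; _≤_; _<_)
open import Data.Sum using (_⊎_)
open import Function.Bundles using (_⇔_)

open import Data.Nat using (zero; suc; _+_; z≤n; s≤s)
import Data.Nat.Properties as ℕ
open import Algebra.Properties.CommutativeSemigroup ℕ.+-commutativeSemigroup using (x∙yz≈y∙xz)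
open import Data.Fin using (Fin; splitAt; join; toℕ)
import Data.Fin as F
import Data.Fin.Properties as F
open import Data.Fin.Permutation using (↔⇒≡)
open import Data.Sum using (inj₁; inj₂)
import Data.Sum as Sum
open import Data.Sum.Properties using (inj₁-injective; inj₂-injective)
open import Data.Sum.Function.Propositional using (_⊎-↔_)
open import Data.Product using (Σ; ∃; ∃-syntax; _×_; _,_; proj₁; proj₂)
open import Data.Product.Function.Dependent.Propositional using (Σ-↔)
open import Data.Unit using (tt)
open import Data.Empty using (⊥; ⊥-elim)
open import Data.Bool using (Bool; true; false; T; not)
open import Relation.Nullary using (¬_; yes; no)
open import Relation.Nullary.Decidable using (False; ⌊_⌋; fromWitnessFalse; toWitnessFalse; toWitness; fromWitness)
open import Relation.Binary.Core using (_Preserves_⟶_)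
open import Relation.Binary.Definitions using (DecidableEquality; tri<; tri≈; tri>)
open import Relation.Binary.PropositionalEquality using (_≡_; refl; sym; trans; cong; subst; subst₂)
open import Function.Base using (id; _∘_)
open import Function.Definitions using (Injective)
open import Function.Bundles using (_↔_; _↣_; Inverse; Injection; mk↔ₛ′; mk⇔; mk↣; Equivalence)
open import Function.Construct.Identity using (↣-id)
open import Function.Properties.Inverse using (↔-refl; ↔-sym; ↔-trans)

mk≅ : ∀ {n m} {P Q : Iposet n m} →
      (f : Iposet.Carrier P → Iposet.Carrier Q) (g : Iposet.Carrier Q → Iposet.Carrier P) →
      (∀ y → f (g y) ≡ y) → (∀ x → g (f x) ≡ x) →
      (∀ x y → Iposet._<ₚ_ P x y → Iposet._<ₚ_ Q (f x) (f y)) →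
      (∀ x y → Iposet._<ₚ_ Q (f x) (f y) → Iposet._<ₚ_ P x y) →
      (∀ i → f (Iposet.s P i) ≡ Iposet.s Q i) → (∀ i → f (Iposet.t P i) ≡ Iposet.t Q i) →
      P ≅ Q
mk≅ f g fg gf mono reflects sc tc = record
  { iso = mk↔ₛ′ f g fg gf
  ; order = λ x y → mk⇔ (mono x y) (reflects x y)
  ; src-com = sc
  ; tgt-com = tc
  }

module Iso {n m} {P Q : Iposet n m} (I : P ≅ Q) where
  private
    module P = Iposet P
    module Q = Iposet Q

  open _≅_ I public using (f; src-com; tgt-com)

  g : Q.Carrier → P.Carrier
  g = Inverse.from (_≅_.iso I)

  f∘g : ∀ y → f (g y) ≡ y
  f∘g = Inverse.strictlyInverseˡ (_≅_.iso I)

  g∘f : ∀ x → g (f x) ≡ x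
  g∘f = Inverse.strictlyInverseʳ (_≅_.iso I)

  f-injective : ∀ {x y} → f x ≡ f y → x ≡ y
  f-injective {x} {y} e = trans (sym (g∘f x)) (trans (cong g e) (g∘f y))

  f-mono : ∀ {x y} → x P.<ₚ y → f x Q.<ₚ f y
  f-mono {x} {y} = Equivalence.to (_≅_.order I x y)

  f-reflects : ∀ {x y} → f x Q.<ₚ f y → x P.<ₚ y
  f-reflects {x} {y} = Equivalence.from (_≅_.order I x y)

≅-sym : ∀ {n m} {P Q : Iposet n m} → P ≅ Q → Q ≅ P
≅-sym {P = P} {Q} I = mk≅ g f g∘f f∘g
  (λ x y lt → f-reflects (subst₂ (Iposet._<ₚ_ Q) (sym (f∘g x)) (sym (f∘g y)) lt))
  (λ x y lt → subst₂ (Iposet._<ₚ_ Q) (f∘g x) (f∘g y) (f-mono lt))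
  (λ i → trans (cong g (sym (src-com i))) (g∘f (Iposet.s P i)))
  (λ i → trans (cong g (sym (tgt-com i))) (g∘f (Iposet.t P i)))
  where open Iso I

≅-trans : ∀ {n m} {P Q R : Iposet n m} → P ≅ Q → Q ≅ R → P ≅ R
≅-trans I J = mk≅ (J.f ∘ I.f) (I.g ∘ J.g)
  (λ z → trans (cong J.f (I.f∘g (J.g z))) (J.f∘g z))
  (λ x → trans (cong I.g (J.g∘f (I.f x))) (I.g∘f x))
  (λ _ _ → J.f-mono ∘ I.f-mono)
  (λ _ _ → I.f-reflects ∘ J.f-reflects)
  (λ i → trans (cong J.f (I.src-com i)) (J.src-com i))
  (λ i → trans (cong J.f (I.tgt-com i)) (J.tgt-com i))
  where
  module I = Iso I
  module J = Iso J

⊗-cong : ∀ {n₁ m₁ n₂ m₂} {A A' : Iposet n₁ m₁} {B B' : Iposet n₂ m₂} →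
         A ≅ A' → B ≅ B' → (A ⊗ B) ≅ (A' ⊗ B')
⊗-cong {n₁} {m₁} {A = A} {A'} {B} {B'} I J =
  mk≅ (Sum.map I.f J.f) (Sum.map I.g J.g) fg gf mono reflects
    (λ i → src (splitAt n₁ i)) (λ i → tgt (splitAt m₁ i))
  where
  module I = Iso I
  module J = Iso J
  fg : ∀ x → Sum.map I.f J.f (Sum.map I.g J.g x) ≡ x
  fg (inj₁ a) = cong inj₁ (I.f∘g a)
  fg (inj₂ b) = cong inj₂ (J.f∘g b)
  gf : ∀ x → Sum.map I.g J.g (Sum.map I.f J.f x) ≡ x
  gf (inj₁ a) = cong inj₁ (I.g∘f a)
  gf (inj₂ b) = cong inj₂ (J.g∘f b)
  mono : ∀ x y → Par._<'_ A B x y → Par._<'_ A' B' (Sum.map I.f J.f x) (Sum.map I.f J.f y)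
  mono (inj₁ _) (inj₁ _) = I.f-mono
  mono (inj₂ _) (inj₂ _) = J.f-mono
  reflects : ∀ x y → Par._<'_ A' B' (Sum.map I.f J.f x) (Sum.map I.f J.f y) → Par._<'_ A B x y
  reflects (inj₁ _) (inj₁ _) = I.f-reflects
  reflects (inj₂ _) (inj₂ _) = J.f-reflects
  src : ∀ x → Sum.map I.f J.f (Par.srcF A B x) ≡ Par.srcF A' B' x
  src (inj₁ a) = cong inj₁ (I.src-com a)
  src (inj₂ b) = cong inj₂ (J.src-com b)
  tgt : ∀ x → Sum.map I.f J.f (Par.tgtF A B x) ≡ Par.tgtF A' B' x
  tgt (inj₁ a) = cong inj₁ (I.tgt-com a)
  tgt (inj₂ b) = cong inj₂ (J.tgt-com b)

module _ {n c m : ℕ} (A : Iposet n c) (B : Iposet c m) where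
  open Glue A B
  private
    module A = Iposet A
    module B = Iposet B

  inj₂-≡ : ∀ {b b'} {p : False (InS? b)} {p' : False (InS? b')} → b ≡ b' →
           _≡_ {A = C} (inj₂ (b , p)) (inj₂ (b' , p'))
  inj₂-≡ {p = p} {p'} refl = cong (λ q → inj₂ (_ , q)) (T-irr p p')

  R2-injective : ∀ x y {b} → R2 x b → R2 y b → x ≡ y
  R2-injective (inj₁ a) (inj₁ a') (i , ta , sb) (i' , ta' , sb') =
    cong inj₁ (trans (sym ta) (trans (cong A.t (B.s-inj _ _ (trans sb (sym sb')))) ta'))
  R2-injective (inj₁ a) (inj₂ (b , p)) (i , _ , sb) refl = ⊥-elim (toWitnessFalse p (i , sb))
  R2-injective (inj₂ (b , p)) (inj₁ a) refl (i , _ , sb) = ⊥-elim (toWitnessFalse p (i , sb))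
  R2-injective (inj₂ _) (inj₂ _) refl refl = inj₂-≡ refl

module ∗-map {n c m : ℕ} {A A' : Iposet n c} {B B' : Iposet c m} (I : A ≅ A') (J : B ≅ B') where
  private
    module I = Iso I
    module J = Iso J
    module G = Glue A B
    module G' = Glue A' B'

  InS-reflects : ∀ b → G'.InS (J.f b) → G.InS b
  InS-reflects b (i , e) = i , J.f-injective (trans (J.src-com i) e)

  InT-reflects : ∀ a → G'.InT (I.f a) → G.InT a
  InT-reflects a (i , e) = i , I.f-injective (trans (I.tgt-com i) e)

  h : G.C → G'.C
  h (inj₁ a) = inj₁ (I.f a)
  h (inj₂ (b , p)) = inj₂ (J.f b , fromWitnessFalse (toWitnessFalse p ∘ InS-reflects b))

  R1-h : ∀ x {a} → G.R1 x a → G'.R1 (h x) (I.f a)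
  R1-h (inj₁ _) refl = refl

  R2-h : ∀ x {b} → G.R2 x b → G'.R2 (h x) (J.f b)
  R2-h (inj₁ a) (i , ta , sb) = i , trans (sym (I.tgt-com i)) (cong I.f ta) , trans (sym (J.src-com i)) (cong J.f sb)
  R2-h (inj₂ _) refl = refl

  h-mono : ∀ x y → G._<'_ x y → G'._<'_ (h x) (h y)
  h-mono x y (inj₁ (a , a' , r , r' , lt)) = inj₁ (I.f a , I.f a' , R1-h x r , R1-h y r' , I.f-mono lt)
  h-mono x y (inj₂ (inj₁ (b , b' , r , r' , lt))) =
    inj₂ (inj₁ (J.f b , J.f b' , R2-h x r , R2-h y r' , J.f-mono lt))
  h-mono x y (inj₂ (inj₂ (a , b , r , nT , r' , nS))) =
    inj₂ (inj₂ (I.f a , J.f b , R1-h x r , nT ∘ InT-reflects a , R2-h y r' , nS ∘ InS-reflects b))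

  h-tgt : ∀ j → h (G.tgt j) ≡ G'.tgt j
  h-tgt j = R2-injective A' B' _ _
    (subst (G'.R2 (h (G.tgt j))) (J.tgt-com j) (R2-h (G.tgt j) (G.R2-tgtOf (Iposet.t B j) (G.InS? (Iposet.t B j)))))
    (G'.R2-tgtOf (Iposet.t B' j) (G'.InS? (Iposet.t B' j)))

∗-cong : ∀ {n c m} {A A' : Iposet n c} {B B' : Iposet c m} →
         A ≅ A' → B ≅ B' → (A ∗ B) ≅ (A' ∗ B')
∗-cong {A = A} {A'} {B} {B'} I J =
  mk≅ H.h H⁻¹.h hh⁻¹ h⁻¹h H.h-mono
    (λ x y lt → subst₂ (Glue._<'_ A B) (h⁻¹h x) (h⁻¹h y) (H⁻¹.h-mono _ _ lt))
    (λ i → cong inj₁ (Iso.src-com I i)) H.h-tgt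
  where
  module H = ∗-map I J
  module H⁻¹ = ∗-map (≅-sym I) (≅-sym J)
  hh⁻¹ : ∀ x → H.h (H⁻¹.h x) ≡ x
  hh⁻¹ (inj₁ a) = cong inj₁ (Iso.f∘g I a)
  hh⁻¹ (inj₂ (b , _)) = inj₂-≡ A' B' (Iso.f∘g J b)
  h⁻¹h : ∀ x → H⁻¹.h (H.h x) ≡ x
  h⁻¹h (inj₁ a) = cong inj₁ (Iso.g∘f I a)
  h⁻¹h (inj₂ (b , _)) = inj₂-≡ A B (Iso.g∘f J b)

ΣT-≡ : ∀ {X : Set} {f : X → Bool} {x x'} {p : T (f x)} {p' : T (f x')} → x ≡ x' →
      _≡_ {A = Σ X (T ∘ f)} (x , p) (x' , p')
ΣT-≡ {p = p} {p'} refl = cong (_ ,_) (T-irr p p')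

module _ {X : Set} {p : ℕ} (h : X ↔ Fin p) where
  private
    module h = Inverse h

    to-injective : ∀ {x y} → h.to x ≡ h.to y → x ≡ y
    to-injective {x} {y} e =
      trans (sym (h.strictlyInverseʳ x)) (trans (cong h.from e) (h.strictlyInverseʳ y))

  missing-< : ∀ {c} (t : Fin c → X) → (∀ i j → t i ≡ t j → i ≡ j) →
              (x : X) → (∀ i → ¬ t i ≡ x) → c < p
  missing-< {c} t t-inj x x∉t = F.injective⇒≤ {f = u} u-injective
    where
    u : Fin (suc c) → Fin p
    u F.zero = h.to x
    u (F.suc i) = h.to (t i)
    u-injective : ∀ {i j} → u i ≡ u j → i ≡ j
    u-injective {F.zero} {F.zero} e = refl
    u-injective {F.zero} {F.suc j} e = ⊥-elim (x∉t j (sym (to-injective e)))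
    u-injective {F.suc i} {F.zero} e = ⊥-elim (x∉t i (to-injective e))
    u-injective {F.suc i} {F.suc j} e = cong F.suc (t-inj i j (to-injective e))

  surjective-or-missing : DecidableEquality X → ∀ {c} (t : Fin c → X) →
    (Σ (X → Fin c) λ t⁻¹ → ∀ x → t (t⁻¹ x) ≡ x) ⊎ (Σ X λ x → ∀ i → ¬ t i ≡ x)
  surjective-or-missing _≟_ t with F.all? (λ j → F.any? (λ i → t i ≟ h.from j))
  ... | yes hit = inj₁ ((λ x → proj₁ (hit (h.to x))) ,
                        (λ x → trans (proj₂ (hit (h.to x))) (h.strictlyInverseʳ x)))
  ... | no ¬hit with F.¬∀⟶∃¬ p _ (λ j → F.any? (λ i → t i ≟ h.from j)) ¬hit
  ...   | j , j∉t = inj₂ (h.from j , λ i e → j∉t (i , e))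

  bijection-size : ∀ {c} (t : Fin c → X) → (∀ i j → t i ≡ t j → i ≡ j) →
                   (t⁻¹ : X → Fin c) → (∀ x → t (t⁻¹ x) ≡ x) → p ≡ c
  bijection-size t t-inj t⁻¹ tt⁻¹ =
    ↔⇒≡ (↔-trans (↔-sym h) (mk↔ₛ′ t⁻¹ t (λ i → t-inj _ _ (tt⁻¹ (t i))) tt⁻¹))

Σ-Fin-suc : ∀ {q} (P : Fin (suc q) → Set) → Σ (Fin (suc q)) P ↔ (P F.zero ⊎ Σ (Fin q) (P ∘ F.suc))
Σ-Fin-suc P = mk↔ₛ′ to from to∘from from∘to
  where
  to : Σ _ P → P F.zero ⊎ Σ _ (P ∘ F.suc)
  to (F.zero , x) = inj₁ x
  to (F.suc i , x) = inj₂ (i , x)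
  from : P F.zero ⊎ Σ _ (P ∘ F.suc) → Σ _ P
  from (inj₁ x) = F.zero , x
  from (inj₂ (i , x)) = F.suc i , x
  to∘from : ∀ y → to (from y) ≡ y
  to∘from (inj₁ _) = refl
  to∘from (inj₂ _) = refl
  from∘to : ∀ x → from (to x) ≡ x
  from∘to (F.zero , _) = refl
  from∘to (F.suc _ , _) = refl

T-finite : ∀ b → ∃ λ d → T b ↔ Fin d
T-finite true = 1 , mk↔ₛ′ (λ _ → F.zero) (λ _ → tt) (λ { F.zero → refl ; (F.suc ()) }) (λ { tt → refl })
T-finite false = 0 , mk↔ₛ′ (λ ()) (λ ()) (λ ()) (λ ())

ΣT-Fin-finite : ∀ q (f : Fin q → Bool) → ∃ λ d → Σ (Fin q) (T ∘ f) ↔ Fin d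
ΣT-Fin-finite zero f = 0 , mk↔ₛ′ (λ ()) (λ ()) (λ ()) (λ ())
ΣT-Fin-finite (suc q) f with T-finite (f F.zero) | ΣT-Fin-finite q (f ∘ F.suc)
... | d₀ , h₀ | d , h = d₀ + d , ↔-trans (Σ-Fin-suc (T ∘ f)) (↔-trans (h₀ ⊎-↔ h) (↔-sym F.+↔⊎))

ΣT-finite : ∀ {X : Set} {q} → X ↔ Fin q → (f : X → Bool) → ∃ λ d → Σ X (T ∘ f) ↔ Fin d
ΣT-finite {q = q} h f with ΣT-Fin-finite q (f ∘ Inverse.from h)
... | d , h' = d , ↔-trans (↔-sym (Σ-↔ (↔-sym h) ↔-refl)) h'

ΣT-split : ∀ {X : Set} (f : X → Bool) → X ↔ (Σ X (T ∘ f) ⊎ Σ X (T ∘ not ∘ f))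
ΣT-split {X} f = mk↔ₛ′ to Sum.[ proj₁ , proj₁ ] to∘from from∘to
  where
  pick : ∀ x b → f x ≡ b → Σ X (T ∘ f) ⊎ Σ X (T ∘ not ∘ f)
  pick x true e = inj₁ (x , subst T (sym e) tt)
  pick x false e = inj₂ (x , subst (T ∘ not) (sym e) tt)
  to : X → Σ X (T ∘ f) ⊎ Σ X (T ∘ not ∘ f)
  to x = pick x (f x) refl
  pick-inj₁ : ∀ x (p : T (f x)) b e → pick x b e ≡ inj₁ (x , p)
  pick-inj₁ x p true e = cong inj₁ (ΣT-≡ refl)
  pick-inj₁ x p false e = ⊥-elim (subst T e p)
  pick-inj₂ : ∀ x (p : T (not (f x))) b e → pick x b e ≡ inj₂ (x , p)
  pick-inj₂ x p true e = ⊥-elim (subst (T ∘ not) e p)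
  pick-inj₂ x p false e = cong inj₂ (ΣT-≡ {f = not ∘ f} refl)
  to∘from : ∀ y → to (Sum.[ proj₁ , proj₁ ] y) ≡ y
  to∘from (inj₁ (x , p)) = pick-inj₁ x p (f x) refl
  to∘from (inj₂ (x , p)) = pick-inj₂ x p (f x) refl
  from∘to : ∀ x → Sum.[ proj₁ , proj₁ ] (to x) ≡ x
  from∘to x = pick-proj (f x) refl
    where
    pick-proj : ∀ b e → Sum.[ proj₁ , proj₁ ] (pick x b e) ≡ x
    pick-proj true _ = refl
    pick-proj false _ = refl

size-unique : ∀ {X : Set} {p q} → X ↔ Fin p → X ↔ Fin q → p ≡ q
size-unique h h' = ↔⇒≡ (↔-trans (↔-sym h) h')

HasSize-≅ : ∀ {n m} {P Q : Iposet n m} {p} → P ≅ Q → HasSize Q p → HasSize P p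
HasSize-≅ I h = ↔-trans (_≅_.iso I) h

size-pos : ∀ {X : Set} {p} → X ↔ Fin p → X → 1 ≤ p
size-pos {p = suc _} _ _ = s≤s z≤n
size-pos {p = zero} h x with Inverse.to h x
... | ()

size-⊗ : ∀ {n₁ m₁ n₂ m₂} {A : Iposet n₁ m₁} {B : Iposet n₂ m₂} {p q} →
         HasSize A p → HasSize B q → HasSize (A ⊗ B) (p + q)
size-⊗ hA hB = ↔-trans (hA ⊎-↔ hB) (↔-sym F.+↔⊎)

module _ {n c m : ℕ} (A : Iposet n c) (B : Iposet c m) where
  open Glue A B
  private
    module B = Iposet B

  sources↔ : Σ B.Carrier (T ∘ ⌊_⌋ ∘ InS?) ↔ Fin c
  sources↔ = mk↔ₛ′ (proj₁ ∘ toWitness ∘ proj₂) (λ i → B.s i , fromWitness (i , refl))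
    (λ i → B.s-inj _ _ (proj₂ (toWitness {a? = InS? (B.s i)} (fromWitness (i , refl)))))
    (λ (b , w) → ΣT-≡ (proj₂ (toWitness w)))

  size-∗ : ∀ {p q} → HasSize A p → HasSize B q → ∃ λ d → c + d ≡ q × HasSize (A ∗ B) (p + d)
  size-∗ {q = q} hA hB with ΣT-finite hB (not ∘ ⌊_⌋ ∘ InS?)
  ... | d , hQ' = d , sym (↔⇒≡ split-q) , ↔-trans (hA ⊎-↔ hQ') (↔-sym F.+↔⊎)
    where
    split-q : Fin q ↔ Fin (c + d)
    split-q = ↔-trans (↔-sym hB) (↔-trans (ΣT-split (⌊_⌋ ∘ InS?))
                (↔-trans (sources↔ ⊎-↔ hQ') (↔-sym F.+↔⊎)))

⟦⟧-inhabited : ∀ {n m} (e : GPTerm n m) → Iposet.Carrier ⟦ e ⟧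
⟦⟧-inhabited (pt _ _) = tt
⟦⟧-inhabited (glue a _) = inj₁ (⟦⟧-inhabited a)
⟦⟧-inhabited (par a _) = inj₁ (⟦⟧-inhabited a)

⟦⟧-finite : ∀ {n m} (e : GPTerm n m) → ∃ (HasSize ⟦ e ⟧)
⟦⟧-finite (pt _ _) = 1 , mk↔ₛ′ (λ _ → F.zero) (λ _ → tt) (λ { F.zero → refl ; (F.suc ()) }) (λ { tt → refl })
⟦⟧-finite (glue a b) with ⟦⟧-finite a | ⟦⟧-finite b
... | p , hA | q , hB with size-∗ ⟦ a ⟧ ⟦ b ⟧ hA hB
...   | d , _ , h = p + d , h
⟦⟧-finite (par a b) with ⟦⟧-finite a | ⟦⟧-finite b
... | p , hA | q , hB = p + q , size-⊗ {A = ⟦ a ⟧} {B = ⟦ b ⟧} hA hB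

gp-term : ∀ {k ℓ p} {P : Iposet k ℓ} → IsGP P → HasSize P p → 1 ≤ p → ∃[ e ] (P ≅ ⟦ e ⟧)
gp-term (inj₁ empty) h (s≤s _) = ⊥-elim (empty (Inverse.from h F.zero))
gp-term (inj₂ gp) _ _ = gp

restrict : ∀ {k n ℓ m} → Fin k ↣ Fin n → Fin ℓ ↣ Fin m → Iposet n m → Iposet k ℓ
restrict σ τ P = record
  { Carrier = P.Carrier ; _≟_ = P._≟_ ; _<ₚ_ = P._<ₚ_ ; irrefl = P.irrefl ; trans< = P.trans<
  ; s = P.s ∘ σ.to ; s-inj = λ i j e → σ.injective (P.s-inj _ _ e) ; s-min = P.s-min ∘ σ.to
  ; t = P.t ∘ τ.to ; t-inj = λ i j e → τ.injective (P.t-inj _ _ e) ; t-max = P.t-max ∘ τ.to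
  }
  where
  module P = Iposet P
  module σ = Injection σ
  module τ = Injection τ

restrict-≅ : ∀ {k n ℓ m} {σ σ' : Fin k ↣ Fin n} {τ τ' : Fin ℓ ↣ Fin m} (P : Iposet n m) →
             (∀ i → Injection.to σ i ≡ Injection.to σ' i) → (∀ j → Injection.to τ j ≡ Injection.to τ' j) →
             restrict σ τ P ≅ restrict σ' τ' P
restrict-≅ P σ≗σ' τ≗τ' = mk≅ id id (λ _ → refl) (λ _ → refl) (λ _ _ → id) (λ _ _ → id)
  (cong (Iposet.s P) ∘ σ≗σ') (cong (Iposet.t P) ∘ τ≗τ')

restrict-∗ : ∀ {k n c m ℓ} (σ : Fin k ↣ Fin n) (τ : Fin ℓ ↣ Fin m) (A : Iposet n c) (B : Iposet c m) →
             restrict σ τ (A ∗ B) ≅ (restrict σ (↣-id (Fin c)) A ∗ restrict (↣-id (Fin c)) τ B)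
restrict-∗ {c = c} σ τ A B = mk≅ id id (λ _ → refl) (λ _ → refl) mono reflects (λ _ → refl) tgt
  where
  A' = restrict σ (↣-id (Fin c)) A
  B' = restrict (↣-id (Fin c)) τ B
  mono : ∀ x y → Glue._<'_ A B x y → Glue._<'_ A' B' x y
  mono (inj₁ _) (inj₁ _) = id
  mono (inj₁ _) (inj₂ _) = id
  mono (inj₂ _) (inj₁ _) = id
  mono (inj₂ _) (inj₂ _) = id
  reflects : ∀ x y → Glue._<'_ A' B' x y → Glue._<'_ A B x y
  reflects (inj₁ _) (inj₁ _) = id
  reflects (inj₁ _) (inj₂ _) = id
  reflects (inj₂ _) (inj₁ _) = id
  reflects (inj₂ _) (inj₂ _) = id
  tgt : ∀ j → let b = Iposet.t B (Injection.to τ j) in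
        Glue.tgtOf A B b (Glue.InS? A B b) ≡
        Glue.tgtOf A' B' b (Glue.InS? A B b)
  tgt j with Glue.InS? A B (Iposet.t B (Injection.to τ j))
  ... | yes _ = refl
  ... | no _ = refl

data OPE : ℕ → ℕ → Set where
  done : OPE 0 0
  keep : ∀ {k n} → OPE k n → OPE (suc k) (suc n)
  skip : ∀ {k n} → OPE k n → OPE k (suc n)

⟦_⟧ₒ : ∀ {k n} → OPE k n → Fin k → Fin n
⟦ keep o ⟧ₒ F.zero = F.zero
⟦ keep o ⟧ₒ (F.suc i) = F.suc (⟦ o ⟧ₒ i)
⟦ skip o ⟧ₒ i = F.suc (⟦ o ⟧ₒ i)

ope-injective : ∀ {k n} (o : OPE k n) → Injective _≡_ _≡_ ⟦ o ⟧ₒ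
ope-injective (keep o) {F.zero} {F.zero} _ = refl
ope-injective (keep o) {F.suc i} {F.suc j} e = cong F.suc (ope-injective o (F.suc-injective e))
ope-injective (skip o) e = ope-injective o (F.suc-injective e)

ope-strictlyMonotone : ∀ {k n} (o : OPE k n) → ⟦ o ⟧ₒ Preserves F._<_ ⟶ F._<_
ope-strictlyMonotone (keep o) {F.zero} {F.suc j} _ = s≤s z≤n
ope-strictlyMonotone (keep o) {F.suc i} {F.suc j} (s≤s lt) = s≤s (ope-strictlyMonotone o lt)
ope-strictlyMonotone (skip o) lt = s≤s (ope-strictlyMonotone o lt)

⟦_⟧↣ : ∀ {k n} → OPE k n → Fin k ↣ Fin n
⟦ o ⟧↣ = mk↣ (ope-injective o)

ope-≤ : ∀ {k n} → OPE k n → k ≤ n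
ope-≤ done = z≤n
ope-≤ (keep o) = s≤s (ope-≤ o)
ope-≤ (skip o) = ℕ.m≤n⇒m≤1+n (ope-≤ o)

ope-id : ∀ {n} → OPE n n
ope-id {zero} = done
ope-id {suc n} = keep ope-id

⟦ope-id⟧ : ∀ {n} (i : Fin n) → ⟦ ope-id ⟧ₒ i ≡ i
⟦ope-id⟧ F.zero = refl
⟦ope-id⟧ (F.suc i) = cong F.suc (⟦ope-id⟧ i)

ope-empty : ∀ {n} → OPE 0 n
ope-empty {zero} = done
ope-empty {suc n} = skip ope-empty

_++ₒ_ : ∀ {k₁ n₁ k₂ n₂} → OPE k₁ n₁ → OPE k₂ n₂ → OPE (k₁ + k₂) (n₁ + n₂)
done ++ₒ o₂ = o₂
keep o ++ₒ o₂ = keep (o ++ₒ o₂)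
skip o ++ₒ o₂ = skip (o ++ₒ o₂)

data Split (n₁ n₂ : ℕ) : ∀ {k} → OPE k (n₁ + n₂) → Set where
  split : ∀ {k₁ k₂} (o₁ : OPE k₁ n₁) (o₂ : OPE k₂ n₂) → Split n₁ n₂ (o₁ ++ₒ o₂)

split? : ∀ n₁ {n₂ k} (o : OPE k (n₁ + n₂)) → Split n₁ n₂ o
split? zero o = split done o
split? (suc n₁) (keep o) with split? n₁ o
... | split o₁ o₂ = split (keep o₁) o₂
split? (suc n₁) (skip o) with split? n₁ o
... | split o₁ o₂ = split (skip o₁) o₂

splitAt-++ₒ : ∀ {k₁ n₁ k₂ n₂} (o₁ : OPE k₁ n₁) (o₂ : OPE k₂ n₂) (i : Fin (k₁ + k₂)) →
              splitAt n₁ (⟦ o₁ ++ₒ o₂ ⟧ₒ i) ≡ Sum.map ⟦ o₁ ⟧ₒ ⟦ o₂ ⟧ₒ (splitAt k₁ i)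
splitAt-++ₒ done o₂ i = refl
splitAt-++ₒ (keep o₁) o₂ F.zero = refl
splitAt-++ₒ {suc k₁} (keep o₁) o₂ (F.suc i) =
  trans (cong (Sum.map₁ F.suc) (splitAt-++ₒ o₁ o₂ i)) (map-suc (splitAt k₁ i))
  where
  map-suc : ∀ x → Sum.map₁ F.suc (Sum.map ⟦ o₁ ⟧ₒ ⟦ o₂ ⟧ₒ x) ≡ Sum.map ⟦ keep o₁ ⟧ₒ ⟦ o₂ ⟧ₒ (Sum.map₁ F.suc x)
  map-suc (inj₁ _) = refl
  map-suc (inj₂ _) = refl
splitAt-++ₒ {k₁} (skip o₁) o₂ i =
  trans (cong (Sum.map₁ F.suc) (splitAt-++ₒ o₁ o₂ i)) (map-suc (splitAt k₁ i))
  where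
  map-suc : ∀ x → Sum.map₁ F.suc (Sum.map ⟦ o₁ ⟧ₒ ⟦ o₂ ⟧ₒ x) ≡ Sum.map ⟦ skip o₁ ⟧ₒ ⟦ o₂ ⟧ₒ x
  map-suc (inj₁ _) = refl
  map-suc (inj₂ _) = refl

module _ {n : ℕ} where
  private
    lower : (x : Fin (suc n)) → 0 < toℕ x → Fin n
    lower (F.suc x) _ = x

    suc-lower : ∀ x (pos : 0 < toℕ x) → F.suc (lower x pos) ≡ x
    suc-lower (F.suc x) _ = refl

    lower-mono : ∀ {x y} (px : 0 < toℕ x) (py : 0 < toℕ y) → x F.< y → lower x px F.< lower y py
    lower-mono {F.suc _} {F.suc _} _ _ (s≤s lt) = lt

  lower-strictlyMonotone : ∀ {k} (σ : Fin k → Fin (suc n)) → σ Preserves F._<_ ⟶ F._<_ →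
    (pos : ∀ i → 0 < toℕ (σ i)) →
    Σ (Fin k → Fin n) λ σ' → σ' Preserves F._<_ ⟶ F._<_ × (∀ i → F.suc (σ' i) ≡ σ i)
  lower-strictlyMonotone σ σ-mono pos =
    (λ i → lower (σ i) (pos i)) , lower-mono (pos _) (pos _) ∘ σ-mono , (λ i → suc-lower (σ i) (pos i))

strictlyMonotone⇒OPE : ∀ {k n} (σ : Fin k → Fin n) → σ Preserves F._<_ ⟶ F._<_ →
                       Σ (OPE k n) λ o → ∀ i → ⟦ o ⟧ₒ i ≡ σ i
strictlyMonotone⇒OPE {zero} σ _ = ope-empty , λ ()
strictlyMonotone⇒OPE {suc k} {zero} σ _ with σ F.zero
... | ()
strictlyMonotone⇒OPE {suc k} {suc n} σ σ-mono with σ F.zero in σ₀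
... | F.zero = keep o , λ { F.zero → sym σ₀ ; (F.suc i) → trans (cong F.suc (⟦o⟧ i)) (suc-σ' i) }
  where
  tail-pos : ∀ i → 0 < toℕ (σ (F.suc i))
  tail-pos i = subst (λ x → toℕ x < toℕ (σ (F.suc i))) σ₀ (σ-mono (s≤s z≤n))
  lowered = lower-strictlyMonotone (σ ∘ F.suc) (σ-mono ∘ s≤s) tail-pos
  σ' = proj₁ lowered
  suc-σ' = proj₂ (proj₂ lowered)
  recursive = strictlyMonotone⇒OPE σ' (proj₁ (proj₂ lowered))
  o = proj₁ recursive
  ⟦o⟧ = proj₂ recursive
... | F.suc _ = skip o , λ i → trans (cong F.suc (⟦o⟧ i)) (suc-σ' i)
  where
  pos : ∀ i → 0 < toℕ (σ i)
  pos F.zero = subst (λ x → 0 < toℕ x) (sym σ₀) (s≤s z≤n)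
  pos (F.suc i) = ℕ.<-trans (pos F.zero) (σ-mono (s≤s z≤n))
  lowered = lower-strictlyMonotone σ σ-mono pos
  σ' = proj₁ lowered
  suc-σ' = proj₂ (proj₂ lowered)
  recursive = strictlyMonotone⇒OPE σ' (proj₁ (proj₂ lowered))
  o = proj₁ recursive
  ⟦o⟧ = proj₂ recursive

ope-reflects-< : ∀ {k n} (o : OPE k n) {i j} → ⟦ o ⟧ₒ i F.< ⟦ o ⟧ₒ j → i F.< j
ope-reflects-< (keep o) {F.zero} {F.suc j} _ = s≤s z≤n
ope-reflects-< (keep o) {F.suc i} {F.suc j} (s≤s lt) = s≤s (ope-reflects-< o lt)
ope-reflects-< (keep o) {F.zero} {F.zero} ()
ope-reflects-< (keep o) {F.suc i} {F.zero} ()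
ope-reflects-< (skip o) (s≤s lt) = ope-reflects-< o lt

<-reflecting⇒strictlyMonotone : ∀ {k n} (σ : Fin k → Fin n) → Injective _≡_ _≡_ σ →
  (∀ {i j} → σ i F.< σ j → i F.< j) → σ Preserves F._<_ ⟶ F._<_
<-reflecting⇒strictlyMonotone σ σ-inj σ-reflects {i} {j} lt with F.<-cmp (σ i) (σ j)
... | tri< σi<σj _ _ = σi<σj
... | tri≈ _ σi≡σj _ = ⊥-elim (F.<-irrefl (σ-inj σi≡σj) lt)
... | tri> _ _ σj<σi = ⊥-elim (F.<-asym lt (σ-reflects σj<σi))

restrictₒ : ∀ {k n ℓ m} → OPE k n → OPE ℓ m → Iposet n m → Iposet k ℓ
restrictₒ o o' = restrict ⟦ o ⟧↣ ⟦ o' ⟧↣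

restrictₒ-id : ∀ {n m} (P : Iposet n m) → P ≅ restrictₒ ope-id ope-id P
restrictₒ-id P = mk≅ id id (λ _ → refl) (λ _ → refl) (λ _ _ → id) (λ _ _ → id)
  (cong (Iposet.s P) ∘ sym ∘ ⟦ope-id⟧) (cong (Iposet.t P) ∘ sym ∘ ⟦ope-id⟧)

restrictₒ-∗ : ∀ {k n c m ℓ} (o : OPE k n) (o' : OPE ℓ m) (A : Iposet n c) (B : Iposet c m) →
              restrictₒ o o' (A ∗ B) ≅ (restrictₒ o ope-id A ∗ restrictₒ ope-id o' B)
restrictₒ-∗ {c = c} o o' A B = ≅-trans (restrict-∗ ⟦ o ⟧↣ ⟦ o' ⟧↣ A B)
  (∗-cong (restrict-≅ {σ = ⟦ o ⟧↣} {⟦ o ⟧↣} {↣-id (Fin c)} {τ' = ⟦ ope-id ⟧↣} A (λ _ → refl) (sym ∘ ⟦ope-id⟧))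
          (restrict-≅ {σ = ↣-id (Fin c)} {⟦ ope-id ⟧↣} {⟦ o' ⟧↣} {⟦ o' ⟧↣} B (sym ∘ ⟦ope-id⟧) (λ _ → refl)))

restrictₒ-⊗ : ∀ {n₁ m₁ n₂ m₂ k₁ k₂ ℓ₁ ℓ₂} (A : Iposet n₁ m₁) (B : Iposet n₂ m₂)
              (o₁ : OPE k₁ n₁) (o₂ : OPE k₂ n₂) (o₁' : OPE ℓ₁ m₁) (o₂' : OPE ℓ₂ m₂) →
              restrictₒ (o₁ ++ₒ o₂) (o₁' ++ₒ o₂') (A ⊗ B) ≅ (restrictₒ o₁ o₁' A ⊗ restrictₒ o₂ o₂' B)
restrictₒ-⊗ {k₁ = k₁} {ℓ₁ = ℓ₁} A B o₁ o₂ o₁' o₂' = mk≅ id id (λ _ → refl) (λ _ → refl) mono reflects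
  (λ i → trans (cong (Par.srcF A B) (splitAt-++ₒ o₁ o₂ i)) (src (splitAt k₁ i)))
  (λ i → trans (cong (Par.tgtF A B) (splitAt-++ₒ o₁' o₂' i)) (tgt (splitAt ℓ₁ i)))
  where
  A' = restrictₒ o₁ o₁' A
  B' = restrictₒ o₂ o₂' B
  src : ∀ x → Par.srcF A B (Sum.map ⟦ o₁ ⟧ₒ ⟦ o₂ ⟧ₒ x) ≡ Par.srcF A' B' x
  src (inj₁ _) = refl
  src (inj₂ _) = refl
  tgt : ∀ x → Par.tgtF A B (Sum.map ⟦ o₁' ⟧ₒ ⟦ o₂' ⟧ₒ x) ≡ Par.tgtF A' B' x
  tgt (inj₁ _) = refl
  tgt (inj₂ _) = refl
  mono : ∀ x y → Par._<'_ A B x y → Par._<'_ A' B' x y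
  mono (inj₁ _) (inj₁ _) = id
  mono (inj₂ _) (inj₂ _) = id
  reflects : ∀ x y → Par._<'_ A' B' x y → Par._<'_ A B x y
  reflects (inj₁ _) (inj₁ _) = id
  reflects (inj₂ _) (inj₂ _) = id

restrictₒ-gp : ∀ {n m k ℓ} (e : GPTerm n m) (o : OPE k n) (o' : OPE ℓ m) →
               ∃[ e' ] (restrictₒ o o' ⟦ e ⟧ ≅ ⟦ e' ⟧)
restrictₒ-gp (pt hn hm) o o' =
  pt (ℕ.≤-trans (ope-≤ o) hn) (ℕ.≤-trans (ope-≤ o') hm) ,
  mk≅ id id (λ _ → refl) (λ _ → refl) (λ _ _ → id) (λ _ _ → id) (λ _ → refl) (λ _ → refl)
restrictₒ-gp (glue a b) o o' with restrictₒ-gp a o ope-id | restrictₒ-gp b ope-id o'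
... | e₁ , I₁ | e₂ , I₂ = glue e₁ e₂ , ≅-trans (restrictₒ-∗ o o' ⟦ a ⟧ ⟦ b ⟧) (∗-cong I₁ I₂)
restrictₒ-gp (par {n₁} {m₁} a b) o o' with split? n₁ o | split? m₁ o'
... | split o₁ o₂ | split o₁' o₂' with restrictₒ-gp a o₁ o₁' | restrictₒ-gp b o₂ o₂'
... | e₁ , I₁ | e₂ , I₂ = par e₁ e₂ , ≅-trans (restrictₒ-⊗ ⟦ a ⟧ ⟦ b ⟧ o₁ o₂ o₁' o₂') (⊗-cong I₁ I₂)

InterfaceMonotone : ∀ {n m} → Iposet n m → Set
InterfaceMonotone P = ∀ {i i' j j'} → Iposet.s P i ≡ Iposet.t P j → Iposet.s P i' ≡ Iposet.t P j' →
                      i F.< i' → j F.< j'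

point-interfaceMonotone : ∀ {n m} (hn : n ≤ 1) (hm : m ≤ 1) → InterfaceMonotone (point n m hn hm)
point-interfaceMonotone hn _ {i} {i'} _ _ lt = ⊥-elim (ℕ.<-irrefl (cong toℕ (fin≤1 hn i i')) lt)

∗-src≡tgt : ∀ {n c m} (A : Iposet n c) (B : Iposet c m) {i j} →
  Iposet.s (A ∗ B) i ≡ Iposet.t (A ∗ B) j →
  ∃[ k ] (Iposet.t A k ≡ Iposet.s A i × Iposet.s B k ≡ Iposet.t B j)
∗-src≡tgt A B {j = j} e = subst (λ x → R2 x (Iposet.t B j)) (sym e) (R2-tgtOf _ (InS? (Iposet.t B j)))
  where open Glue A B

∗-interfaceMonotone : ∀ {n c m} {A : Iposet n c} {B : Iposet c m} →
  InterfaceMonotone A → InterfaceMonotone B → InterfaceMonotone (A ∗ B)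
∗-interfaceMonotone {A = A} {B} mA mB e e' lt with ∗-src≡tgt A B e | ∗-src≡tgt A B e'
... | _ , tk , sk | _ , tk' , sk' = mB sk sk' (mA (sym tk) (sym tk') lt)

private
  position : ∀ a {b} → Fin a ⊎ Fin b → ℕ
  position a (inj₁ x) = toℕ x
  position a (inj₂ y) = a + toℕ y

  toℕ-position : ∀ a {b} (i : Fin (a + b)) → toℕ i ≡ position a (splitAt a i)
  toℕ-position a {b} i = trans (cong toℕ (sym (F.join-splitAt a b i))) (toℕ-join (splitAt a i))
    where
    toℕ-join : ∀ x → toℕ (join a b x) ≡ position a x
    toℕ-join (inj₁ x) = F.toℕ-↑ˡ x b
    toℕ-join (inj₂ y) = F.toℕ-↑ʳ a y

module _ {n₁ m₁ n₂ m₂} {A : Iposet n₁ m₁} {B : Iposet n₂ m₂}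
         (mA : InterfaceMonotone A) (mB : InterfaceMonotone B) where
  open Par A B using (srcF; tgtF)

  private
    split-monotone : ∀ x x' y y' → srcF x ≡ tgtF y → srcF x' ≡ tgtF y' →
                     position n₁ x < position n₁ x' → position m₁ y < position m₁ y'
    split-monotone (inj₁ _) (inj₁ _) (inj₁ _) (inj₁ _) e e' lt = mA (inj₁-injective e) (inj₁-injective e') lt
    split-monotone (inj₁ _) (inj₂ _) (inj₁ c) (inj₂ _) _ _ _ = ℕ.<-≤-trans (F.toℕ<n c) (ℕ.m≤m+n m₁ _)
    split-monotone (inj₂ _) (inj₁ a') (inj₂ _) (inj₁ _) _ _ lt =
      ⊥-elim (ℕ.<-asym lt (ℕ.<-≤-trans (F.toℕ<n a') (ℕ.m≤m+n n₁ _)))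
    split-monotone (inj₂ _) (inj₂ _) (inj₂ _) (inj₂ _) e e' lt =
      ℕ.+-monoʳ-< m₁ (mB (inj₂-injective e) (inj₂-injective e') (ℕ.+-cancelˡ-< n₁ _ _ lt))
    split-monotone (inj₁ _) _ (inj₂ _) _ () _ _
    split-monotone (inj₂ _) _ (inj₁ _) _ () _ _
    split-monotone (inj₁ _) (inj₁ _) (inj₁ _) (inj₂ _) _ () _
    split-monotone (inj₁ _) (inj₂ _) (inj₁ _) (inj₁ _) _ () _
    split-monotone (inj₂ _) (inj₂ _) (inj₂ _) (inj₁ _) _ () _
    split-monotone (inj₂ _) (inj₁ _) (inj₂ _) (inj₂ _) _ () _

  ⊗-interfaceMonotone : InterfaceMonotone (A ⊗ B)
  ⊗-interfaceMonotone {i} {i'} {j} {j'} e e' lt =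
    subst₂ _<_ (sym (toℕ-position m₁ j)) (sym (toℕ-position m₁ j'))
      (split-monotone _ _ _ _ e e' (subst₂ _<_ (toℕ-position n₁ i) (toℕ-position n₁ i') lt))

⟦⟧-interfaceMonotone : ∀ {n m} (e : GPTerm n m) → InterfaceMonotone ⟦ e ⟧
⟦⟧-interfaceMonotone (pt hn hm) = point-interfaceMonotone hn hm
⟦⟧-interfaceMonotone (glue a b) = ∗-interfaceMonotone (⟦⟧-interfaceMonotone a) (⟦⟧-interfaceMonotone b)
⟦⟧-interfaceMonotone (par a b) = ⊗-interfaceMonotone (⟦⟧-interfaceMonotone a) (⟦⟧-interfaceMonotone b)

module _ {n c m : ℕ} (A : Iposet n c) (B : Iposet c m) where
  private
    module A = Iposet A
    module B = Iposet B
  open Glue A B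

  ∗-collapseˡ : (t⁻¹ : A.Carrier → Fin c) → (∀ a → A.t (t⁻¹ a) ≡ a) →
    ∀ {k ℓ} (σ : Fin k ↣ Fin n) (τ : Fin ℓ ↣ Fin m) (σ' : Fin k ↣ Fin c) →
    (∀ i → A.t (Injection.to σ' i) ≡ A.s (Injection.to σ i)) →
    restrict σ τ (A ∗ B) ≅ restrict σ' τ B
  ∗-collapseˡ t⁻¹ tt⁻¹ σ τ σ' σ'≈σ = mk≅ to from to∘from from∘to mono reflects sources (to∘from ∘ B.t ∘ Injection.to τ)
    where
    t⁻¹t : ∀ k → t⁻¹ (A.t k) ≡ k
    t⁻¹t k = A.t-inj _ _ (tt⁻¹ (A.t k))
    to : C → B.Carrier
    to (inj₁ a) = B.s (t⁻¹ a)
    to (inj₂ (b , _)) = b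
    from : B.Carrier → C
    from b = tgtOf b (InS? b)
    R2-to : ∀ x → R2 x (to x)
    R2-to (inj₁ a) = t⁻¹ a , tt⁻¹ a , refl
    R2-to (inj₂ _) = refl
    R2⇒to : ∀ x {b} → R2 x b → b ≡ to x
    R2⇒to x r = R2-fun x r (R2-to x)
    to∘from : ∀ b → to (from b) ≡ b
    to∘from b = sym (R2⇒to (from b) (R2-tgtOf b (InS? b)))
    from∘to : ∀ x → from (to x) ≡ x
    from∘to x = R2-injective A B _ _ (R2-tgtOf (to x) (InS? (to x))) (R2-to x)
    mono : ∀ x y → x <' y → to x B.<ₚ to y
    mono x y (inj₁ (a , a' , _ , _ , lt)) = ⊥-elim (below-T lt (t⁻¹ a , tt⁻¹ a))
    mono x y (inj₂ (inj₁ (b , b' , r , r' , lt))) = subst₂ B._<ₚ_ (R2⇒to x r) (R2⇒to y r') lt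
    mono x y (inj₂ (inj₂ (a , _ , _ , a∉t , _ , _))) = ⊥-elim (a∉t (t⁻¹ a , tt⁻¹ a))
    reflects : ∀ x y → to x B.<ₚ to y → x <' y
    reflects x y lt = inj₂ (inj₁ (to x , to y , R2-to x , R2-to y , lt))
    sources : ∀ i → B.s (t⁻¹ (A.s (Injection.to σ i))) ≡ B.s (Injection.to σ' i)
    sources i = trans (cong (B.s ∘ t⁻¹) (sym (σ'≈σ i))) (cong B.s (t⁻¹t _))

  ∗-collapseʳ : (s⁻¹ : B.Carrier → Fin c) → (∀ b → B.s (s⁻¹ b) ≡ b) →
    ∀ {k ℓ} (σ : Fin k ↣ Fin n) (τ : Fin ℓ ↣ Fin m) (τ' : Fin ℓ ↣ Fin c) →
    (∀ j → B.s (Injection.to τ' j) ≡ B.t (Injection.to τ j)) →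
    restrict σ τ (A ∗ B) ≅ restrict σ τ' A
  ∗-collapseʳ s⁻¹ ss⁻¹ σ τ τ' τ'≈τ = mk≅ to inj₁ (λ _ → refl) from∘to mono reflects (λ _ → refl) targets
    where
    no-Q' : Q' → ⊥
    no-Q' (b , p) = toWitnessFalse p (s⁻¹ b , ss⁻¹ b)
    to : C → A.Carrier
    to (inj₁ a) = a
    to (inj₂ b) = ⊥-elim (no-Q' b)
    from∘to : ∀ x → inj₁ (to x) ≡ x
    from∘to (inj₁ _) = refl
    from∘to (inj₂ b) = ⊥-elim (no-Q' b)
    mono : ∀ x y → x <' y → to x A.<ₚ to y
    mono (inj₂ b) _ _ = ⊥-elim (no-Q' b)
    mono (inj₁ _) (inj₂ b) _ = ⊥-elim (no-Q' b)
    mono (inj₁ _) (inj₁ _) (inj₁ (_ , _ , refl , refl , lt)) = lt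
    mono (inj₁ _) (inj₁ _) (inj₂ (inj₁ (_ , _ , _ , (i , _ , sb) , lt))) = ⊥-elim (above-S lt (i , sb))
    mono (inj₁ _) (inj₁ _) (inj₂ (inj₂ (_ , _ , _ , _ , (i , _ , sb) , b∉s))) = ⊥-elim (b∉s (i , sb))
    reflects : ∀ x y → to x A.<ₚ to y → x <' y
    reflects (inj₂ b) _ _ = ⊥-elim (no-Q' b)
    reflects (inj₁ _) (inj₂ b) _ = ⊥-elim (no-Q' b)
    reflects (inj₁ a) (inj₁ a') lt = inj₁ (a , a' , refl , refl , lt)
    targets : ∀ j → to (tgt (Injection.to τ j)) ≡ A.t (Injection.to τ' j)
    targets j with InS? (B.t (Injection.to τ j))
    ... | yes (i , e) = cong A.t (B.s-inj _ _ (trans e (sym (τ'≈τ j))))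
    ... | no b∉s = ⊥-elim (b∉s (_ , τ'≈τ j))

glue-arithmetic : ∀ {c p q d} → c < p → c < q → c + d ≡ q → p < p + d × q < p + d × c + (p + d) ≡ p + q
glue-arithmetic {c} {p} {q} {d} c<p c<q c+d≡q = ℕ.m<m+n p 0<d , subst (_< p + d) c+d≡q (ℕ.+-monoˡ-< d c<p) ,
  trans (x∙yz≈y∙xz c p d) (cong (p +_) c+d≡q)
  where
  0<d : 0 < d
  0<d = ℕ.+-cancelˡ-< c 0 d (subst₂ _<_ (sym (ℕ.+-identityʳ c)) (sym c+d≡q) c<q)

Decomposable : ∀ {k ℓ} → ℕ → Iposet k ℓ → Set₁
Decomposable n P = InGlueUnion n P ⊎ InParUnion n P

Decomposable-≅ : ∀ {k ℓ n} {P P' : Iposet k ℓ} → P ≅ P' → Decomposable n P' → Decomposable n P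
Decomposable-≅ I (inj₁ (p , q , m , 1≤p , p<n , 1≤q , q<n , m+n≡p+q , m<p , m<q , P₁ , P₂ , g₁ , g₂ , J)) =
  inj₁ (p , q , m , 1≤p , p<n , 1≤q , q<n , m+n≡p+q , m<p , m<q , P₁ , P₂ , g₁ , g₂ , ≅-trans I J)
Decomposable-≅ I (inj₂ (p , q , k₁ , k₂ , ℓ₁ , ℓ₂ , p+q , 1≤p , 1≤q , ek , eℓ , P₁ , P₂ , g₁ , g₂ , J)) =
  inj₂ (p , q , k₁ , k₂ , ℓ₁ , ℓ₂ , p+q , 1≤p , 1≤q , ek , eℓ , P₁ , P₂ , g₁ , g₂ , ≅-trans I J)

restrictₒ-decomposable : ∀ {n m k ℓ N} (e : GPTerm n m) (o : OPE k n) (o' : OPE ℓ m) →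
  HasSize ⟦ e ⟧ N → 1 < N → Decomposable N (restrictₒ o o' ⟦ e ⟧)
restrictₒ-decomposable (pt hn hm) o o' h 1<N =
  ⊥-elim (ℕ.<-irrefl (size-unique (proj₂ (⟦⟧-finite (pt hn hm))) h) 1<N)
restrictₒ-decomposable (par {n₁} {m₁} a b) o o' h _
  with split? n₁ o | split? m₁ o' | ⟦⟧-finite a | ⟦⟧-finite b
... | split {k₁} {k₂} o₁ o₂ | split {ℓ₁} {ℓ₂} o₁' o₂' | p , hA | q , hB =
  inj₂ (p , q , k₁ , k₂ , ℓ₁ , ℓ₂ , size-unique (size-⊗ {A = ⟦ a ⟧} {B = ⟦ b ⟧} hA hB) h ,
        size-pos hA (⟦⟧-inhabited a) , size-pos hB (⟦⟧-inhabited b) , refl , refl ,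
        restrictₒ o₁ o₁' ⟦ a ⟧ , restrictₒ o₂ o₂' ⟦ b ⟧ ,
        (inj₂ (restrictₒ-gp a o₁ o₁') , hA) , (inj₂ (restrictₒ-gp b o₂ o₂') , hB) ,
        restrictₒ-⊗ ⟦ a ⟧ ⟦ b ⟧ o₁ o₂ o₁' o₂')
restrictₒ-decomposable {k = k} {ℓ} {N} (glue {k = c} a b) o o' h 1<N
  with ⟦⟧-finite a | ⟦⟧-finite b
... | p , hA | q , hB with size-∗ ⟦ a ⟧ ⟦ b ⟧ hA hB
... | d , c+d≡q , hAB
  with surjective-or-missing hA (Iposet._≟_ ⟦ a ⟧) (Iposet.t ⟦ a ⟧)
     | surjective-or-missing hB (Iposet._≟_ ⟦ b ⟧) (Iposet.s ⟦ b ⟧)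
... | inj₁ (t⁻¹ , tt⁻¹) | _ =
  Decomposable-≅ (∗-collapseˡ ⟦ a ⟧ ⟦ b ⟧ t⁻¹ tt⁻¹ ⟦ o ⟧↣ ⟦ o' ⟧↣ ⟦ r ⟧↣ (λ i → trans (cong A.t (⟦r⟧ i)) (tt⁻¹ _)))
    (restrictₒ-decomposable b r o' (subst (HasSize ⟦ b ⟧) (sym N≡q) hB) 1<N)
  where
  module A = Iposet ⟦ a ⟧
  N≡q : N ≡ q
  N≡q = trans (size-unique h hAB)
          (trans (cong (_+ d) (bijection-size hA A.t A.t-inj t⁻¹ tt⁻¹)) c+d≡q)
  σ' : Fin k → Fin c
  σ' = t⁻¹ ∘ A.s ∘ ⟦ o ⟧ₒ
  σ'-mono : σ' Preserves F._<_ ⟶ F._<_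
  σ'-mono = ⟦⟧-interfaceMonotone a (sym (tt⁻¹ _)) (sym (tt⁻¹ _)) ∘ ope-strictlyMonotone o
  r = proj₁ (strictlyMonotone⇒OPE σ' σ'-mono)
  ⟦r⟧ = proj₂ (strictlyMonotone⇒OPE σ' σ'-mono)
... | inj₂ _ | inj₁ (s⁻¹ , ss⁻¹) =
  Decomposable-≅ (∗-collapseʳ ⟦ a ⟧ ⟦ b ⟧ s⁻¹ ss⁻¹ ⟦ o ⟧↣ ⟦ o' ⟧↣ ⟦ r ⟧↣ (λ j → trans (cong B.s (⟦r⟧ j)) (ss⁻¹ _)))
    (restrictₒ-decomposable a o r (subst (HasSize ⟦ a ⟧) (sym N≡p) hA) 1<N)
  where
  module B = Iposet ⟦ b ⟧
  d≡0 : d ≡ 0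
  d≡0 = ℕ.+-cancelˡ-≡ c d 0
          (trans c+d≡q (trans (bijection-size hB B.s B.s-inj s⁻¹ ss⁻¹) (sym (ℕ.+-identityʳ c))))
  N≡p : N ≡ p
  N≡p = trans (size-unique h hAB) (trans (cong (p +_) d≡0) (ℕ.+-identityʳ p))
  τ' : Fin ℓ → Fin c
  τ' = s⁻¹ ∘ B.t ∘ ⟦ o' ⟧ₒ
  τ'-mono : τ' Preserves F._<_ ⟶ F._<_
  τ'-mono = <-reflecting⇒strictlyMonotone τ'
    (λ e → ope-injective o' (B.t-inj _ _ (trans (sym (ss⁻¹ _)) (trans (cong B.s e) (ss⁻¹ _)))))
    (ope-reflects-< o' ∘ ⟦⟧-interfaceMonotone b (ss⁻¹ _) (ss⁻¹ _))
  r = proj₁ (strictlyMonotone⇒OPE τ' τ'-mono)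
  ⟦r⟧ = proj₂ (strictlyMonotone⇒OPE τ' τ'-mono)
... | inj₂ (x , x∉t) | inj₂ (y , y∉s) =
  inj₁ (p , q , c , size-pos hA (⟦⟧-inhabited a) , p<N , size-pos hB (⟦⟧-inhabited b) , q<N , c+N , c<p , c<q ,
        restrictₒ o ope-id ⟦ a ⟧ , restrictₒ ope-id o' ⟦ b ⟧ ,
        (inj₂ (restrictₒ-gp a o ope-id) , hA) , (inj₂ (restrictₒ-gp b ope-id o') , hB) ,
        restrictₒ-∗ o o' ⟦ a ⟧ ⟦ b ⟧)
  where
  module A = Iposet ⟦ a ⟧
  module B = Iposet ⟦ b ⟧
  c<p : c < p
  c<p = missing-< hA A.t A.t-inj x x∉t
  c<q : c < q
  c<q = missing-< hB B.s B.s-inj y y∉s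
  N≡p+d : N ≡ p + d
  N≡p+d = size-unique h hAB
  p<N : p < N
  p<N = subst (p <_) (sym N≡p+d) (proj₁ (glue-arithmetic c<p c<q c+d≡q))
  q<N : q < N
  q<N = subst (q <_) (sym N≡p+d) (proj₁ (proj₂ (glue-arithmetic c<p c<q c+d≡q)))
  c+N : c + N ≡ p + q
  c+N = subst (λ z → c + z ≡ p + q) (sym N≡p+d) (proj₂ (proj₂ (glue-arithmetic c<p c<q c+d≡q)))

gp-decomposable : ∀ {k ℓ} n → 1 < n → (P : Iposet k ℓ) → InG n P → Decomposable n P
gp-decomposable n 1<n P (gp , h) with gp-term gp h (ℕ.<⇒≤ 1<n)
... | e , I = Decomposable-≅ (≅-trans I (restrictₒ-id ⟦ e ⟧))
                (restrictₒ-decomposable e ope-id ope-id (↔-trans (↔-sym (_≅_.iso I)) h) 1<n)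

decomposable-gp : ∀ {k ℓ} n (P : Iposet k ℓ) → Decomposable n P → InG n P
decomposable-gp n P (inj₁ (p , q , m , 1≤p , _ , 1≤q , _ , m+n≡p+q , _ , _ , P₁ , P₂ , (g₁ , h₁) , (g₂ , h₂) , I))
  with gp-term g₁ h₁ 1≤p | gp-term g₂ h₂ 1≤q | size-∗ P₁ P₂ h₁ h₂
... | e₁ , I₁ | e₂ , I₂ | d , m+d≡q , h =
  inj₂ (glue e₁ e₂ , ≅-trans I (∗-cong I₁ I₂)) , HasSize-≅ I (subst (HasSize (P₁ ∗ P₂)) (sym n≡p+d) h)
  where
  n≡p+d : n ≡ p + d
  n≡p+d = ℕ.+-cancelˡ-≡ m n (p + d)
            (trans m+n≡p+q (trans (cong (p +_) (sym m+d≡q)) (sym (x∙yz≈y∙xz m p d))))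
decomposable-gp n P (inj₂ (p , q , _ , _ , _ , _ , p+q≡n , 1≤p , 1≤q , refl , refl , P₁ , P₂ , (g₁ , h₁) , (g₂ , h₂) , I))
  with gp-term g₁ h₁ 1≤p | gp-term g₂ h₂ 1≤q
... | e₁ , I₁ | e₂ , I₂ =
  inj₂ (par e₁ e₂ , ≅-trans I (⊗-cong I₁ I₂)) ,
  HasSize-≅ I (subst (HasSize (P₁ ⊗ P₂)) p+q≡n (size-⊗ {A = P₁} {B = P₂} h₁ h₂))

lemma1 : (n k ℓ : ℕ) → 1 < n → k ≤ n → ℓ ≤ n → (P : Iposet k ℓ) →
    InG n P ⇔ (InGlueUnion n P ⊎ InParUnion n P)
lemma1 n _ _ 1<n _ _ P = mk⇔ (gp-decomposable n 1<n P) (decomposable-gp n P)
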